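{- Let $(H,\bar y)$ and $(H',\bar y')$ be involution-free graphs, each with $r$ distinguished vertices. Then $(H,\bar y)\cong(H',\bar y')$ if and only if, for every (not necessarily connected) graph $(G,\bar x)$ with $r$ distinguished vertices, $$|\mathrm{Hom}((G,\bar x),(H,\bar y))|\equiv|\mathrm{Hom}((G,\bar x),(H',\bar y'))|\pmod 2.$$
   Context: Graphs are finite, simple, undirected, loopless. A graph with $r$ distinguished vertices $(G,x_1,\dots,x_r)$, abbreviated $(G,\bar x)$, is a graph $G$ together with a sequence of $r$ (not necessarily distinct) vertices. A homomorphism from $(G,\bar x)$ to $(H,\bar y)$ is a graph homomorphism $\sigma:G\to H$ (edges to edges) with $\sigma(x_j)=y_j$ for all $j$; $\mathrm{Hom}((G,\bar x),(H,\bar y))$ is the set of these. $(G,\bar x)\cong(H,\bar y)$ means there is a graph isomorphism $\rho:G\to H$ with $\rho(x_j)=y_j$ for all $j$. An automorphism of $(H,\bar y)$ is an automorphism of $H$ fixing each $y_j$; $(H,\bar y)$ is involution-free if it has no automorphism of order $2$. -}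

module Defs where

open import Data.Nat using (ℕ; zero; suc; _%_)
open import Data.Bool using (Bool; true; false; T; T?)
open import Data.Fin using (Fin)
open import Data.Fin.Properties using (all?; _≟_)
open import Data.Vec using (Vec; []; _∷_; lookup)
open import Data.List using (List; [_]; concatMap; map; filter; length; allFin)
open import Data.Product using (Σ; _×_; _,_; ∃)
open import Relation.Nullary using (¬_; Dec)
open import Relation.Nullary.Decidable using (_×-dec_; _→-dec_)
open import Relation.Binary.PropositionalEquality using (_≡_)

record Graph : Set where
  field
    n      : ℕ
    adj    : Fin n → Fin n → Bool
    sym    : ∀ u v → adj u v ≡ adj v u
    irrefl : ∀ u → adj u u ≡ false
open Graph public

record RGraph (r : ℕ) : Set where
  field
    graph : Graph
    dist  : Fin r → Fin (n graph)
open RGraph public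

Edge : (G : Graph) → Fin (n G) → Fin (n G) → Set
Edge G u v = T (adj G u v)

-- A vertex map G → H is represented by the vector of images (so that
-- distinct maps are distinct elements and can be counted).
IsHom : ∀ {r} (G H : RGraph r) → Vec (Fin (n (graph H))) (n (graph G)) → Set
IsHom G H f =
  (∀ u v → Edge (graph G) u v → Edge (graph H) (lookup f u) (lookup f v))
  × (∀ j → lookup f (dist G j) ≡ dist H j)

isHom? : ∀ {r} (G H : RGraph r) → (f : Vec (Fin (n (graph H))) (n (graph G))) → Dec (IsHom G H f)
isHom? G H f =
  all? (λ u → all? (λ v → T? (adj (graph G) u v) →-dec T? (adj (graph H) (lookup f u) (lookup f v))))
  ×-dec all? (λ j → lookup f (dist G j) ≟ dist H j)

allMaps : (k m : ℕ) → List (Vec (Fin m) k)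
allMaps zero    m = [ [] ]
allMaps (suc k) m = concatMap (λ i → map (i ∷_) (allMaps k m)) (allFin m)

homCount : ∀ {r} (G H : RGraph r) → ℕ
homCount G H = length (filter (isHom? G H) (allMaps (n (graph G)) (n (graph H))))

_≅_ : ∀ {r} → RGraph r → RGraph r → Set
_≅_ G H =
  Σ (Fin (n (graph G)) → Fin (n (graph H))) λ ρ →
  Σ (Fin (n (graph H)) → Fin (n (graph G))) λ ρ⁻ →
    (∀ u → ρ⁻ (ρ u) ≡ u) × (∀ v → ρ (ρ⁻ v) ≡ v)
    × (∀ u v → adj (graph H) (ρ u) (ρ v) ≡ adj (graph G) u v)
    × (∀ j → ρ (dist G j) ≡ dist H j)

-- Automorphism of (H,ȳ): an isomorphism (H,ȳ) → (H,ȳ); given as a map σ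
-- with inverse σ⁻. It has order 2 iff σ∘σ = id and σ ≠ id.
IsInvolution : ∀ {r} (H : RGraph r) → (Fin (n (graph H)) → Fin (n (graph H))) → Set
IsInvolution H σ =
  Σ (Fin (n (graph H)) → Fin (n (graph H))) λ σ⁻ →
    (∀ u → σ⁻ (σ u) ≡ u) × (∀ v → σ (σ⁻ v) ≡ v)
    × (∀ u v → adj (graph H) (σ u) (σ v) ≡ adj (graph H) u v)
    × (∀ j → σ (dist H j) ≡ dist H j)
    × (∀ u → σ (σ u) ≡ u)
    × (∃ λ u → ¬ (σ u ≡ u))

InvolutionFree : ∀ {r} → RGraph r → Set
InvolutionFree H = ¬ (∃ λ σ → IsInvolution H σ)

-- Isomorphic targets have equinumerous Hom-sets. Conversely, let hom_D(G, K) count the homomorphisms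
-- G → K separating every pair in the list D. A homomorphism either separates one more pair u v or
-- identifies u and v; the latter do not exist if u ∼ v, and otherwise are the homomorphisms out of the
-- graph G/uv obtained by merging u and v. By induction on the number of vertices and then on D,
-- hom_D(G, H) ≡ hom_D(G, H′) mod 2 for all G and D. For G = H and D all pairs of distinct vertices,
-- hom_D(H, H) counts automorphisms, and σ ↦ σ⁻¹ pairs them up apart from those of order at most 2,
-- which for involution-free H is only the identity. Hence hom_D(H, H′) is odd, giving an injective
-- homomorphism H → H′, and symmetrically H′ → H; comparing vertex and edge counts, such a map is an
-- isomorphism.

module Submission where

open import Defs hiding (sym)
open import Data.Bool using (T)
open import Data.Fin using (Fin; punchIn; punchOut) renaming (_<_ to _<ᶠ_)
import Data.Fin.Properties as Fin
open import Data.List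
  using (List; []; _∷_; _++_; length; map; filter; concatMap; allFin; cartesianProductWith; cartesianProduct)
open import Data.List.Properties using (filter-≐; filter-none; length-map; length-tabulate)
import Data.List.Membership.DecPropositional as DecMembership
open import Data.List.Membership.Propositional using (_∈_)
open import Data.List.Membership.Propositional.Properties
  using (∈-map⁻; ∈-filter⁺; ∈-filter⁻; ∈-allFin; ∈-cartesianProductWith⁺; ∈-cartesianProduct⁺)
open import Data.List.Relation.Binary.Subset.Propositional using (_⊆_)
open import Data.List.Relation.Unary.All using (All; []; _∷_)
import Data.List.Relation.Unary.All as All
open import Data.List.Relation.Unary.All.Properties using (¬Any⇒All¬; all-filter)
import Data.List.Relation.Unary.All.Properties as All
open import Data.List.Relation.Unary.AllPairs using ([]; _∷_)
open import Data.List.Relation.Unary.Any using (here; there)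
import Data.List.Relation.Unary.Any as Any
open import Data.List.Relation.Unary.Unique.Propositional using (Unique)
import Data.List.Relation.Unary.Unique.Propositional.Properties as Unique
open import Data.Nat using (ℕ; zero; suc; _+_; _*_; _≤_; _<_; _%_; z≤n; s≤s)
open import Data.Nat.DivMod using (%-distribˡ-+; [m+kn]%n≡m%n)
open import Data.Nat.Induction using (<-rec)
open import Data.Nat.Properties
  using (≤-antisym; ≤-trans; ≤-refl; n<1+n; 1+n≰n; +-suc; +-assoc; +-comm; +-identityʳ; *-comm)
open import Data.Product using (∃; ∃₂; _×_; _,_; proj₁; proj₂)
import Data.Product as Product
import Data.Product.Properties as Product
open import Data.Sum using (_⊎_; inj₁; inj₂)
open import Data.Vec using (Vec; []; _∷_; lookup; tabulate)
import Data.Vec as Vec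
open import Data.Vec.Properties using (∷-injective; lookup∘tabulate; tabulate∘lookup; tabulate-cong)
import Data.Vec.Properties as Vec
open import Data.Vec.Relation.Binary.Lex.Strict using (Lex-<)
import Data.Vec.Relation.Binary.Lex.Strict as Lex
open import Data.Vec.Relation.Binary.Pointwise.Inductive using (Pointwise-≡⇒≡; ≡⇒Pointwise-≡)
open import Function using (_∘_; id)
open import Function.Bundles using (mk⇔)
open import Function.Definitions using (Injective)
open import Level using (0ℓ)
open import Relation.Binary using (Rel; DecidableEquality; Trichotomous; tri<; tri≈; tri>)
open import Relation.Binary.Consequences using (tri⇒dec≈; tri⇒dec<; tri⇒asym)
open import Relation.Binary.PropositionalEquality
  using (_≡_; _≢_; refl; sym; trans; cong; cong₂; subst; subst₂; module ≡-Reasoning)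
open import Relation.Nullary using (¬_; Dec; yes; no; ¬?; _×-dec_; _→-dec_; contradiction)
open import Relation.Nullary.Decidable using (isYes; isYes≗does; does-⇔; dec-false; toWitness; fromWitness; T?)
open import Relation.Unary using (Pred; Decidable; _≐_; ∁)
open import Relation.Unary.Properties using (_∩?_; ∁?)

private
  variable
    A B : Set

count : {P : Pred A 0ℓ} → Decidable P → List A → ℕ
count P? xs = length (filter P? xs)

module _ {P Q : Pred A 0ℓ} (P? : Decidable P) (Q? : Decidable Q) where

  count-≐ : P ≐ Q → ∀ xs → count P? xs ≡ count Q? xs
  count-≐ P≐Q xs = cong length (filter-≐ P? Q? P≐Q xs)

  count-∩-∁ : ∀ xs → count P? xs ≡ count (P? ∩? Q?) xs + count (P? ∩? ∁? Q?) xs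
  count-∩-∁ [] = refl
  count-∩-∁ (x ∷ xs) with P? x | Q? x
  ... | yes _ | yes _ = cong suc (count-∩-∁ xs)
  ... | yes _ | no _ = trans (cong suc (count-∩-∁ xs)) (sym (+-suc _ _))
  ... | no _ | _ = count-∩-∁ xs

module _ {P : Pred A 0ℓ} (P? : Decidable P) where

  count-none : ∀ {xs} → All (∁ P) xs → count P? xs ≡ 0
  count-none none = cong length (filter-none P? none)

  count≢0⇒∃ : ∀ xs → count P? xs ≢ 0 → ∃ P
  count≢0⇒∃ xs count≢0 with Any.any? P? xs
  ... | yes some = Any.satisfied some
  ... | no none = contradiction (count-none (¬Any⇒All¬ xs none)) count≢0

count-≡ : (_≟_ : DecidableEquality A) (x : A) → ∀ {xs} → Unique xs → x ∈ xs → count (_≟ x) xs ≡ 1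
count-≡ _≟_ x (x∉xs ∷ _) (here refl) with x ≟ x
... | yes _ = cong suc (count-none (_≟ x) (All.map (λ x≢y y≡x → x≢y (sym y≡x)) x∉xs))
... | no x≢x = contradiction refl x≢x
count-≡ _≟_ x {y ∷ ys} (y∉ys ∷ unique) (there x∈ys) with y ≟ x
... | yes refl = contradiction refl (All.lookup y∉ys x∈ys)
... | no _ = count-≡ _≟_ x unique x∈ys

remove-member : ∀ {y : A} {ys} → y ∈ ys →
  ∃ λ zs → length ys ≡ suc (length zs) × (∀ {w} → w ∈ ys → w ≢ y → w ∈ zs)
remove-member {ys = _ ∷ ys} (here refl) =
  ys , refl , λ { (here refl) w≢y → contradiction refl w≢y ; (there w∈) _ → w∈ }
remove-member {ys = y′ ∷ _} (there y∈) with zs , length≡ , ⊆zs ← remove-member y∈ =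
  y′ ∷ zs , cong suc length≡ , λ { (here refl) _ → here refl ; (there w∈) w≢y → there (⊆zs w∈ w≢y) }

Unique-⊆⇒length≤ : ∀ {xs ys : List A} → Unique xs → xs ⊆ ys → length xs ≤ length ys
Unique-⊆⇒length≤ {xs = []} _ _ = z≤n
Unique-⊆⇒length≤ {xs = x ∷ xs} (x∉xs ∷ unique) xs⊆ys
  with zs , length≡ , ⊆zs ← remove-member (xs⊆ys (here refl)) =
  subst (suc (length xs) ≤_) (sym length≡) (s≤s (Unique-⊆⇒length≤ unique
    λ w∈ → ⊆zs (xs⊆ys (there w∈)) λ { refl → All.lookup x∉xs w∈ refl }))

Unique-⊆-length≥⇒⊇ : DecidableEquality A → ∀ {xs ys : List A} →
  Unique xs → xs ⊆ ys → length ys ≤ length xs → ys ⊆ xs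
Unique-⊆-length≥⇒⊇ _≟_ {xs} {ys} unique xs⊆ys ys≤xs {y} y∈ys with DecMembership._∈?_ _≟_ y xs
... | yes y∈xs = y∈xs
... | no y∉xs = contradiction (≤-trans (Unique-⊆⇒length≤ y∷xs-unique y∷xs⊆ys) ys≤xs) 1+n≰n
  where
  y∷xs-unique : Unique (y ∷ xs)
  y∷xs-unique = All.tabulate (λ w∈ → λ { refl → y∉xs w∈ }) ∷ unique
  y∷xs⊆ys : y ∷ xs ⊆ ys
  y∷xs⊆ys (here refl) = y∈ys
  y∷xs⊆ys (there w∈) = xs⊆ys w∈

Unique-map⁺-on : ∀ {P : Pred A 0ℓ} (φ : A → B) → (∀ {x y} → P x → P y → φ x ≡ φ y → x ≡ y) →
  ∀ {xs} → All P xs → Unique xs → Unique (map φ xs)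
Unique-map⁺-on φ inj [] [] = []
Unique-map⁺-on φ inj (px ∷ pxs) (x∉xs ∷ unique) =
  All.map⁺ (All.zipWith (λ (py , x≢y) φx≡φy → x≢y (inj px py φx≡φy)) (pxs , x∉xs))
  ∷ Unique-map⁺-on φ inj pxs unique

record Enumeration (A : Set) : Set where
  field
    elements : List A
    unique   : Unique elements
    complete : ∀ x → x ∈ elements
open Enumeration

module _ {P : Pred A 0ℓ} {Q : Pred B 0ℓ} (P? : Decidable P) (Q? : Decidable Q) where

  count-injection : (φ : A → B) → (∀ {x} → P x → Q (φ x)) →
    (∀ {x y} → P x → P y → φ x ≡ φ y → x ≡ y) →
    (E : Enumeration A) (F : Enumeration B) → count P? (elements E) ≤ count Q? (elements F)
  count-injection φ φ-maps φ-inj E F =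
    subst (_≤ count Q? (elements F)) (length-map φ (filter P? (elements E)))
      (Unique-⊆⇒length≤ (Unique-map⁺-on φ φ-inj (all-filter P? (elements E)) (Unique.filter⁺ P? (unique E)))
        image⊆)
    where
    image⊆ : map φ (filter P? (elements E)) ⊆ filter Q? (elements F)
    image⊆ w∈ with x , x∈ , refl ← ∈-map⁻ φ w∈ =
      ∈-filter⁺ Q? (complete F (φ x)) (φ-maps (proj₂ (∈-filter⁻ P? {xs = elements E} x∈)))

count-bijection : {P : Pred A 0ℓ} {Q : Pred B 0ℓ} (P? : Decidable P) (Q? : Decidable Q) (φ : A → B) (ψ : B → A) →
  (∀ {x} → P x → Q (φ x)) → (∀ {y} → Q y → P (ψ y)) →
  (∀ {x} → P x → ψ (φ x) ≡ x) → (∀ {y} → Q y → φ (ψ y) ≡ y) →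
  (E : Enumeration A) (F : Enumeration B) → count P? (elements E) ≡ count Q? (elements F)
count-bijection P? Q? φ ψ φ-maps ψ-maps ψφ φψ E F = ≤-antisym
  (count-injection P? Q? φ φ-maps (λ px py eq → trans (sym (ψφ px)) (trans (cong ψ eq) (ψφ py))) E F)
  (count-injection Q? P? ψ ψ-maps (λ qx qy eq → trans (sym (φψ qx)) (trans (cong φ eq) (φψ qy))) F E)

concatMap≡cartesianProductWith : ∀ {k m} (is : List (Fin m)) (vs : List (Vec (Fin m) k)) →
  concatMap (λ i → map (i ∷_) vs) is ≡ cartesianProductWith _∷_ is vs
concatMap≡cartesianProductWith [] vs = refl
concatMap≡cartesianProductWith (i ∷ is) vs = cong (map (i ∷_) vs ++_) (concatMap≡cartesianProductWith is vs)

maps : (k m : ℕ) → Enumeration (Vec (Fin m) k)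
maps k m = record { elements = allMaps k m ; unique = allMaps-unique k ; complete = allMaps-complete k }
  where
  allMaps-unique : ∀ k → Unique (allMaps k m)
  allMaps-unique zero = [] ∷ []
  allMaps-unique (suc k) = subst Unique (sym (concatMap≡cartesianProductWith (allFin m) (allMaps k m)))
    (Unique.cartesianProductWith⁺ _∷_ ∷-injective (Unique.allFin⁺ m) (allMaps-unique k))
  allMaps-complete : ∀ k (v : Vec (Fin m) k) → v ∈ allMaps k m
  allMaps-complete zero [] = here refl
  allMaps-complete (suc k) (i ∷ v) = subst ((i ∷ v) ∈_) (sym (concatMap≡cartesianProductWith (allFin m) (allMaps k m)))
    (∈-cartesianProductWith⁺ _∷_ (∈-allFin i) (allMaps-complete k v))

pairs : (k : ℕ) → Enumeration (Fin k × Fin k)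
pairs k = record
  { elements = cartesianProduct (allFin k) (allFin k)
  ; unique   = Unique.cartesianProduct⁺ (Unique.allFin⁺ k) (Unique.allFin⁺ k)
  ; complete = λ (x , y) → ∈-cartesianProduct⁺ (∈-allFin x) (∈-allFin y)
  }

tabulate≡ : ∀ {k} {g : Fin k → A} {v : Vec A k} → (∀ i → g i ≡ lookup v i) → tabulate g ≡ v
tabulate≡ {v = v} g≗v = trans (tabulate-cong g≗v) (tabulate∘lookup v)

lookup-ext : ∀ {k} {v w : Vec A k} → (∀ i → lookup v i ≡ lookup w i) → v ≡ w
lookup-ext {v = v} v≗w = trans (sym (tabulate∘lookup v)) (tabulate≡ v≗w)

infix 4 _≡₂_
_≡₂_ : ℕ → ℕ → Set
m ≡₂ n = m % 2 ≡ n % 2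

+-cong-≡₂ : ∀ {a a′ b b′} → a ≡₂ a′ → b ≡₂ b′ → a + b ≡₂ a′ + b′
+-cong-≡₂ {a} {a′} {b} {b′} a≡a′ b≡b′ = begin
  (a + b) % 2           ≡⟨ %-distribˡ-+ a b 2 ⟩
  (a % 2 + b % 2) % 2   ≡⟨ cong₂ (λ x y → (x + y) % 2) a≡a′ b≡b′ ⟩
  (a′ % 2 + b′ % 2) % 2 ≡⟨ %-distribˡ-+ a′ b′ 2 ⟨
  (a′ + b′) % 2         ∎
  where open ≡-Reasoning

m+[n+n]≡₂m : ∀ m n → m + (n + n) ≡₂ m
m+[n+n]≡₂m m n = trans (cong (λ k → (m + k) % 2) n+n≡n*2) ([m+kn]%n≡m%n m n 2)
  where
  n+n≡n*2 : n + n ≡ n * 2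
  n+n≡n*2 = trans (cong (n +_) (sym (+-identityʳ n))) (*-comm 2 n)

+-cancelʳ-≡₂ : ∀ {a a′ x x′} → a + x ≡₂ a′ + x′ → x ≡₂ x′ → a ≡₂ a′
+-cancelʳ-≡₂ {a} {a′} {x} {x′} a+x≡a′+x′ x≡x′ = begin
  a % 2                ≡⟨ m+[n+n]≡₂m a x ⟨
  (a + (x + x)) % 2    ≡⟨ cong (_% 2) (+-assoc a x x) ⟨
  ((a + x) + x) % 2    ≡⟨ +-cong-≡₂ {a + x} {a′ + x′} a+x≡a′+x′ x≡x′ ⟩
  ((a′ + x′) + x′) % 2 ≡⟨ cong (_% 2) (+-assoc a′ x′ x′) ⟩
  (a′ + (x′ + x′)) % 2 ≡⟨ m+[n+n]≡₂m a′ x′ ⟩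
  a′ % 2               ∎
  where open ≡-Reasoning

module _ {_<_ : Rel A 0ℓ} (compare : Trichotomous _≡_ _<_) (ι : A → A) where

  fixed? : Decidable (λ x → ι x ≡ x)
  fixed? x = tri⇒dec≈ compare (ι x) x

  -- The non-fixed points split into those below and those above their image, and ι swaps the two halves.
  count≡₂count-fixed : ∀ {P : Pred A 0ℓ} (P? : Decidable P) →
    (∀ {x} → P x → P (ι x)) → (∀ {x} → P x → ι (ι x) ≡ x) →
    (E : Enumeration A) → count P? (elements E) ≡₂ count (P? ∩? fixed?) (elements E)
  count≡₂count-fixed {P} P? ι-closed ι-involutive E = begin
    count P? xs % 2                  ≡⟨ cong (_% 2) (count-∩-∁ P? fixed? xs) ⟩
    (count Fix? xs + count Mov? xs) % 2 ≡⟨ cong (λ k → (count Fix? xs + k) % 2) (count-∩-∁ Mov? ascending? xs) ⟩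
    (count Fix? xs + (count Up? xs + count Down? xs)) % 2
      ≡⟨ cong (λ k → (count Fix? xs + (k + count Down? xs)) % 2)
           (count-bijection Up? Down? ι ι up→down down→up
              (ι-involutive ∘ proj₁ ∘ proj₁) (ι-involutive ∘ proj₁ ∘ proj₁) E E) ⟩
    (count Fix? xs + (count Down? xs + count Down? xs)) % 2 ≡⟨ m+[n+n]≡₂m (count Fix? xs) (count Down? xs) ⟩
    count Fix? xs % 2                ∎
    where
    open ≡-Reasoning
    xs : List A
    xs = elements E
    ascending? : Decidable (λ x → x < ι x)
    ascending? x = tri⇒dec< compare x (ι x)
    Fix? : Decidable (λ x → P x × ι x ≡ x)
    Fix? = P? ∩? fixed?
    Mov? : Decidable (λ x → P x × ι x ≢ x)
    Mov? = P? ∩? ∁? fixed?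
    Up? : Decidable (λ x → (P x × ι x ≢ x) × x < ι x)
    Up? = Mov? ∩? ascending?
    Down? : Decidable (λ x → (P x × ι x ≢ x) × ¬ (x < ι x))
    Down? = Mov? ∩? ∁? ascending?
    moved : ∀ {x} → P x → ι x ≢ x → ι (ι x) ≢ ι x
    moved px ιx≢x ιιx≡ιx = ιx≢x (trans (sym ιιx≡ιx) (ι-involutive px))
    up→down : ∀ {x} → (P x × ι x ≢ x) × x < ι x → (P (ι x) × ι (ι x) ≢ ι x) × ¬ (ι x < ι (ι x))
    up→down ((px , ιx≢x) , x<ιx) =
      (ι-closed px , moved px ιx≢x) , λ ιx<ιιx → tri⇒asym compare x<ιx (subst (ι _ <_) (ι-involutive px) ιx<ιιx)
    down→up : ∀ {x} → (P x × ι x ≢ x) × ¬ (x < ι x) → (P (ι x) × ι (ι x) ≢ ι x) × ι x < ι (ι x)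
    down→up {x} ((px , ιx≢x) , x≮ιx) with compare x (ι x)
    ... | tri< x<ιx _ _ = contradiction x<ιx x≮ιx
    ... | tri≈ _ x≡ιx _ = contradiction (sym x≡ιx) ιx≢x
    ... | tri> _ _ ιx<x = (ι-closed px , moved px ιx≢x) , subst (ι x <_) (sym (ι-involutive px)) ιx<x

lex-compare : ∀ {k n} → Trichotomous _≡_ (Lex-< _≡_ (_<ᶠ_ {k}) {n} {n})
lex-compare v w with Lex.<-cmp sym Fin.<-cmp v w
... | tri< v<w v≢w v≯w = tri< v<w (v≢w ∘ ≡⇒Pointwise-≡) v≯w
... | tri≈ v≮w v≡w v≯w = tri≈ v≮w (Pointwise-≡⇒≡ v≡w) v≯w
... | tri> v≮w v≢w v>w = tri> v≮w (v≢w ∘ ≡⇒Pointwise-≡) v>w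

Edge-sym : ∀ (A : Graph) {u v} → Edge A u v → Edge A v u
Edge-sym A {u} {v} = subst T (Graph.sym A u v)

Edge-irrefl : ∀ (A : Graph) {u} → ¬ Edge A u u
Edge-irrefl A {u} e = subst T (irrefl A u) e

module _ {r : ℕ} where

  Map : RGraph r → RGraph r → Set
  Map G K = Vec (Fin (n (graph K))) (n (graph G))

  mapsBetween : (G K : RGraph r) → Enumeration (Map G K)
  mapsBetween G K = maps (n (graph G)) (n (graph K))

≅-sym : ∀ {r} {G H : RGraph r} → G ≅ H → H ≅ G
≅-sym {G = G} {H} (ρ , ρ⁻ , ρ⁻∘ρ , ρ∘ρ⁻ , adj-ρ , dist-ρ) =
  ρ⁻ , ρ , ρ∘ρ⁻ , ρ⁻∘ρ ,
  (λ u v → trans (sym (adj-ρ (ρ⁻ u) (ρ⁻ v))) (cong₂ (adj (graph H)) (ρ∘ρ⁻ u) (ρ∘ρ⁻ v))) ,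
  (λ j → trans (cong ρ⁻ (sym (dist-ρ j))) (ρ⁻∘ρ (dist G j)))

≅-hom : ∀ {r} {K G H : RGraph r} (iso : G ≅ H) {f : Map K G} → IsHom K G f → IsHom K H (Vec.map (proj₁ iso) f)
≅-hom {K = K} {G} {H} (ρ , _ , _ , _ , adj-ρ , dist-ρ) {f} (f-hom , f-dist) =
  (λ u v e → subst₂ (Edge (graph H)) (sym (Vec.lookup-map u ρ f)) (sym (Vec.lookup-map v ρ f))
               (subst T (sym (adj-ρ _ _)) (f-hom u v e))) ,
  (λ j → trans (Vec.lookup-map (dist K j) ρ f) (trans (cong ρ (f-dist j)) (dist-ρ j)))

homCount-resp-≅ : ∀ {r} {G H : RGraph r} → G ≅ H → ∀ K → homCount K G ≡ homCount K H
homCount-resp-≅ {G = G} {H} iso@(ρ , ρ⁻ , ρ⁻∘ρ , ρ∘ρ⁻ , _) K =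
  count-bijection (isHom? K G) (isHom? K H) (Vec.map ρ) (Vec.map ρ⁻)
    (λ {f} → ≅-hom {K = K} {G} {H} iso {f}) (λ {f} → ≅-hom {K = K} {H} {G} (≅-sym {G = G} {H} iso) {f})
    (λ {f} _ → map-inverse {h = ρ} ρ⁻∘ρ f) (λ {f} _ → map-inverse {h = ρ⁻} ρ∘ρ⁻ f)
    (mapsBetween K G) (mapsBetween K H)
  where
  map-inverse : ∀ {A B : Set} {k} {g : B → A} {h : A → B} →
    (∀ x → g (h x) ≡ x) → (v : Vec A k) → Vec.map g (Vec.map h v) ≡ v
  map-inverse {g = g} {h} g∘h v = trans (sym (Vec.map-∘ g h v)) (trans (Vec.map-cong g∘h v) (Vec.map-id v))

Separates : ∀ {k m} → List (Fin k × Fin k) → Vec (Fin m) k → Set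
Separates D f = All (λ p → lookup f (proj₁ p) ≢ lookup f (proj₂ p)) D

separates? : ∀ {k m} (D : List (Fin k × Fin k)) → Decidable (Separates {m = m} D)
separates? D f = All.all? (λ p → ¬? (lookup f (proj₁ p) Fin.≟ lookup f (proj₂ p))) D

Merges : ∀ {k m} → Fin k → Fin k → Vec (Fin m) k → Set
Merges u v f = lookup f u ≡ lookup f v

merges? : ∀ {k m} (u v : Fin k) → Decidable (Merges {m = m} u v)
merges? u v f = lookup f u Fin.≟ lookup f v

VertexPairs : ∀ {r} → RGraph r → Set
VertexPairs G = List (Fin (n (graph G)) × Fin (n (graph G)))

module _ {r : ℕ} (G K : RGraph r) where

  SepHom : VertexPairs G → Map G K → Set
  SepHom D f = IsHom G K f × Separates D f

  sepHom? : ∀ D → Decidable (SepHom D)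
  sepHom? D = isHom? G K ∩? separates? D

  sepHomCount : VertexPairs G → ℕ
  sepHomCount D = count (sepHom? D) (elements (mapsBetween G K))

  mergingCount : VertexPairs G → (u v : Fin (n (graph G))) → ℕ
  mergingCount D u v = count (sepHom? D ∩? merges? u v) (elements (mapsBetween G K))

  sepHomCount-[] : sepHomCount [] ≡ homCount G K
  sepHomCount-[] = count-≐ (sepHom? []) (isHom? G K) (proj₁ , (_, [])) (elements (mapsBetween G K))

  sepHomCount-∷ : ∀ D u v → sepHomCount D ≡ sepHomCount ((u , v) ∷ D) + mergingCount D u v
  sepHomCount-∷ D u v = begin
    sepHomCount D                                                  ≡⟨ count-∩-∁ (sepHom? D) (merges? u v) fs ⟩
    mergingCount D u v + count (sepHom? D ∩? ∁? (merges? u v)) fs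
      ≡⟨ cong (mergingCount D u v +_) (count-≐ _ (sepHom? ((u , v) ∷ D)) separating fs) ⟩
    mergingCount D u v + sepHomCount ((u , v) ∷ D) ≡⟨ +-comm (mergingCount D u v) _ ⟩
    sepHomCount ((u , v) ∷ D) + mergingCount D u v ∎
    where
    open ≡-Reasoning
    fs : List (Map G K)
    fs = elements (mapsBetween G K)
    separating : (λ f → SepHom D f × ¬ Merges u v f) ≐ SepHom ((u , v) ∷ D)
    separating = (λ ((h , sep) , fu≢fv) → h , fu≢fv ∷ sep) , λ { (h , fu≢fv ∷ sep) → (h , sep) , fu≢fv }

  sepHomCount-self : ∀ D u → sepHomCount ((u , u) ∷ D) ≡ 0
  sepHomCount-self D u = count-none (sepHom? ((u , u) ∷ D)) {elements (mapsBetween G K)}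
    (All.universal (λ { f (_ , fu≢fu ∷ _) → fu≢fu refl }) _)

  mergingCount-edge : ∀ D {u v} → Edge (graph G) u v → mergingCount D u v ≡ 0
  mergingCount-edge D {u} {v} e = count-none (sepHom? D ∩? merges? u v) {elements (mapsBetween G K)}
    (All.universal (λ f (((hom , _) , _) , fu≡fv) →
      Edge-irrefl (graph K) (subst (λ x → Edge (graph K) x (lookup f v)) fu≡fv (hom u v e))) _)

module Image {r : ℕ} (G : RGraph r) {m : ℕ} (c : Fin (n (graph G)) → Fin m) where

  ImageEdge : Fin m → Fin m → Set
  ImageEdge x y = ∃₂ λ w w′ → c w ≡ x × c w′ ≡ y × Edge (graph G) w w′

  imageEdge? : ∀ x y → Dec (ImageEdge x y)
  imageEdge? x y = Fin.any? λ w → Fin.any? λ w′ →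
    (c w Fin.≟ x) ×-dec (c w′ Fin.≟ y) ×-dec T? (adj (graph G) w w′)

  ConstantOnFibres : ∀ {k} → Vec (Fin k) (n (graph G)) → Set
  ConstantOnFibres f = ∀ w w′ → c w ≡ c w′ → lookup f w ≡ lookup f w′

  constantOnFibres? : ∀ {k} → Decidable (ConstantOnFibres {k})
  constantOnFibres? f = Fin.all? λ w → Fin.all? λ w′ → (c w Fin.≟ c w′) →-dec (lookup f w Fin.≟ lookup f w′)

  module _ (fibres-independent : ∀ w w′ → c w ≡ c w′ → ¬ Edge (graph G) w w′) where

    image : RGraph r
    image = record
      { graph = record
        { n      = m
        -- isYes rather than does, so that edges are read off with toWitness/fromWitness.
        ; adj    = λ x y → isYes (imageEdge? x y)
        ; sym    = λ x y → trans (isYes≗does _)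
                     (trans (does-⇔ (mk⇔ swap swap) (imageEdge? x y) (imageEdge? y x)) (sym (isYes≗does _)))
        ; irrefl = λ x → trans (isYes≗does _) (dec-false (imageEdge? x x) λ (w , w′ , cw≡x , cw′≡x , e) →
                     fibres-independent w w′ (trans cw≡x (sym cw′≡x)) e)
        }
      ; dist = c ∘ dist G
      }
      where
      swap : ∀ {x y} → ImageEdge x y → ImageEdge y x
      swap (w , w′ , cw≡x , cw′≡y , e) = w′ , w , cw′≡y , cw≡x , Edge-sym (graph G) e

    module _ (s : Fin m → Fin (n (graph G))) (c∘s : ∀ x → c (s x) ≡ x) (K : RGraph r) where

      descend : Map G K → Map image K
      descend f = tabulate (lookup f ∘ s)

      lift : Map image K → Map G K
      lift g = tabulate (lookup g ∘ c)

      lookup-descend : ∀ f → ConstantOnFibres f → ∀ w → lookup (descend f) (c w) ≡ lookup f w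
      lookup-descend f const w = trans (lookup∘tabulate (lookup f ∘ s) (c w)) (const (s (c w)) w (c∘s (c w)))

      lookup-lift : ∀ g w → lookup (lift g) w ≡ lookup g (c w)
      lookup-lift g = lookup∘tabulate (lookup g ∘ c)

      count-constantOnFibres : ∀ D → count (sepHom? G K D ∩? constantOnFibres?) (elements (mapsBetween G K))
                                     ≡ sepHomCount image K (map (Product.map c c) D)
      count-constantOnFibres D =
        count-bijection (sepHom? G K D ∩? constantOnFibres?) (sepHom? image K (map (Product.map c c) D)) descend lift
        (λ {f} → descend-sepHom {f}) (λ {g} → lift-sepHom {g})
        (λ {f} (_ , const) → tabulate≡ (lookup-descend f const))
        (λ {g} _ → tabulate≡ λ x → trans (lookup-lift g (s x)) (cong (lookup g) (c∘s x)))
        (mapsBetween G K) (mapsBetween image K)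
        where
        descend-sepHom : ∀ {f} → SepHom G K D f × ConstantOnFibres f → SepHom image K (map (Product.map c c) D) (descend f)
        descend-sepHom {f} (((hom , fixes) , sep) , const) = (edges , dists) ,
          All.map⁺ (All.map (λ fp≢fq eq →
            fp≢fq (trans (sym (lookup-descend f const _)) (trans eq (lookup-descend f const _)))) sep)
          where
          edges : ∀ x y → Edge (graph image) x y → Edge (graph K) (lookup (descend f) x) (lookup (descend f) y)
          edges x y e with w , w′ , refl , refl , e′ ← toWitness e =
            subst₂ (Edge (graph K)) (sym (lookup-descend f const w)) (sym (lookup-descend f const w′)) (hom w w′ e′)
          dists : ∀ j → lookup (descend f) (c (dist G j)) ≡ dist K j
          dists j = trans (lookup-descend f const (dist G j)) (fixes j)

        lift-sepHom : ∀ {g} → SepHom image K (map (Product.map c c) D) g → SepHom G K D (lift g) × ConstantOnFibres (lift g)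
        lift-sepHom {g} ((hom , fixes) , sep) =
          ((edges , λ j → trans (lookup-lift g (dist G j)) (fixes j)) ,
           All.map (λ gp≢gq eq → gp≢gq (trans (sym (lookup-lift g _)) (trans eq (lookup-lift g _)))) (All.map⁻ sep)) ,
          λ w w′ cw≡cw′ → trans (lookup-lift g w) (trans (cong (lookup g) cw≡cw′) (sym (lookup-lift g w′)))
          where
          edges : ∀ w w′ → Edge (graph G) w w′ → Edge (graph K) (lookup (lift g) w) (lookup (lift g) w′)
          edges w w′ e = subst₂ (Edge (graph K)) (sym (lookup-lift g w)) (sym (lookup-lift g w′))
            (hom (c w) (c w′) (fromWitness (w , w′ , refl , refl , e)))

record Merging {k : ℕ} (u v : Fin k) : Set where
  field
    size            : ℕ
    size<k          : size < k
    merge           : Fin k → Fin size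
    section         : Fin size → Fin k
    merge∘section   : ∀ x → merge (section x) ≡ x
    merge-u≡merge-v : merge u ≡ merge v
    merge-fibre     : ∀ {w w′} → merge w ≡ merge w′ → w ≢ w′ → (w ≡ u × w′ ≡ v) ⊎ (w ≡ v × w′ ≡ u)

merging : ∀ {k} {u v : Fin k} → u ≢ v → Merging u v
merging {suc m} {u} {v} u≢v = record
  { size            = m
  ; size<k          = n<1+n m
  ; merge           = merge
  ; section         = punchIn v
  ; merge∘section   = merge∘punchIn
  ; merge-u≡merge-v = merge-u≡merge-v
  ; merge-fibre     = merge-fibre
  }
  where
  v≢u : v ≢ u
  v≢u = u≢v ∘ sym

  merge : Fin (suc m) → Fin m
  merge w with v Fin.≟ w
  ... | yes _   = punchOut v≢u
  ... | no v≢w = punchOut v≢w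

  merge∘punchIn : ∀ x → merge (punchIn v x) ≡ x
  merge∘punchIn x with v Fin.≟ punchIn v x
  ... | yes v≡ = contradiction (sym v≡) (Fin.punchInᵢ≢i v x)
  ... | no _   = trans (Fin.punchOut-cong v refl) (Fin.punchOut-punchIn v)

  merge-u≡merge-v : merge u ≡ merge v
  merge-u≡merge-v with v Fin.≟ u | v Fin.≟ v
  ... | yes v≡u | _     = contradiction v≡u v≢u
  ... | no _    | yes _ = Fin.punchOut-cong v refl
  ... | no _    | no v≢v = contradiction refl v≢v

  merge-fibre : ∀ {w w′} → merge w ≡ merge w′ → w ≢ w′ → (w ≡ u × w′ ≡ v) ⊎ (w ≡ v × w′ ≡ u)
  merge-fibre {w} {w′} eq w≢w′ with v Fin.≟ w | v Fin.≟ w′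
  ... | yes refl | yes refl = contradiction refl w≢w′
  ... | yes refl | no v≢w′  = inj₂ (refl , sym (Fin.punchOut-injective v≢u v≢w′ eq))
  ... | no v≢w   | yes refl = inj₁ (Fin.punchOut-injective v≢w v≢u eq , refl)
  ... | no v≢w   | no v≢w′  = contradiction (Fin.punchOut-injective v≢w v≢w′ eq) w≢w′

module Merged {r : ℕ} (G : RGraph r) {u v : Fin (n (graph G))} (u≢v : u ≢ v) (u≁v : ¬ Edge (graph G) u v) where
  open Merging (merging u≢v) public

  fibres-independent : ∀ w w′ → merge w ≡ merge w′ → ¬ Edge (graph G) w w′
  fibres-independent w w′ eq e with w Fin.≟ w′
  ... | yes refl = Edge-irrefl (graph G) e
  ... | no w≢w′ with merge-fibre eq w≢w′
  ... | inj₁ (refl , refl) = u≁v e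
  ... | inj₂ (refl , refl) = u≁v (Edge-sym (graph G) e)

  merged : RGraph r
  merged = Image.image G merge fibres-independent

  mergingCount≡sepHomCount : ∀ K D → mergingCount G K D u v ≡ sepHomCount merged K (map (Product.map merge merge) D)
  mergingCount≡sepHomCount K D =
    trans (count-≐ (sepHom? G K D ∩? merges? u v) (sepHom? G K D ∩? Image.constantOnFibres? G merge)
                   ((λ {f} (h , fu≡fv) → h , constant {f} fu≡fv) , (λ (h , const) → h , const u v merge-u≡merge-v))
                   (elements (mapsBetween G K)))
          (Image.count-constantOnFibres G merge fibres-independent section merge∘section K D)
    where
    constant : ∀ {f : Map G K} → Merges u v f → Image.ConstantOnFibres G merge f
    constant fu≡fv w w′ eq with w Fin.≟ w′
    ... | yes refl = refl
    ... | no w≢w′ with merge-fibre eq w≢w′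
    ... | inj₁ (refl , refl) = fu≡fv
    ... | inj₂ (refl , refl) = sym fu≡fv

sepHomCount-∷-≡₂ : ∀ {r} (H H′ G : RGraph r) D u v →
  sepHomCount G H D ≡₂ sepHomCount G H′ D → mergingCount G H D u v ≡₂ mergingCount G H′ D u v →
  sepHomCount G H ((u , v) ∷ D) ≡₂ sepHomCount G H′ ((u , v) ∷ D)
sepHomCount-∷-≡₂ H H′ G D u v same merging-same =
  +-cancelʳ-≡₂ {sepHomCount G H ((u , v) ∷ D)} {sepHomCount G H′ ((u , v) ∷ D)} {mergingCount G H D u v}
    (subst₂ _≡₂_ (sepHomCount-∷ G H D u v) (sepHomCount-∷ G H′ D u v) same) merging-same

module _ {r : ℕ} {H H′ : RGraph r} (same-parity : ∀ G → homCount G H ≡₂ homCount G H′) where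

  sepHomCount-≡₂ : ∀ G D → sepHomCount G H D ≡₂ sepHomCount G H′ D
  sepHomCount-≡₂ G D = <-rec P step (n (graph G)) G refl D
    where
    P : ℕ → Set
    P k = ∀ (G : RGraph r) → n (graph G) ≡ k → ∀ D → sepHomCount G H D ≡₂ sepHomCount G H′ D
    step : ∀ k → (∀ {l} → l < k → P l) → P k
    step k smaller G refl = by-separation
      where
      by-separation : ∀ D → sepHomCount G H D ≡₂ sepHomCount G H′ D
      by-separation [] = subst₂ _≡₂_ (sym (sepHomCount-[] G H)) (sym (sepHomCount-[] G H′)) (same-parity G)
      by-separation ((u , v) ∷ D) with u Fin.≟ v | T? (adj (graph G) u v)
      ... | yes refl | _ = cong (_% 2) (trans (sepHomCount-self G H D u) (sym (sepHomCount-self G H′ D u)))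
      ... | no u≢v | yes u∼v = sepHomCount-∷-≡₂ H H′ G D u v (by-separation D)
        (cong (_% 2) (trans (mergingCount-edge G H D u∼v) (sym (mergingCount-edge G H′ D u∼v))))
      ... | no u≢v | no u≁v = sepHomCount-∷-≡₂ H H′ G D u v (by-separation D)
        (subst₂ _≡₂_ (sym (mergingCount≡sepHomCount H D)) (sym (mergingCount≡sepHomCount H′ D))
          (smaller size<k merged refl _))
        where open Merged G u≢v u≁v

distinct? : ∀ {k} → Decidable (λ (p : Fin k × Fin k) → proj₁ p ≢ proj₂ p)
distinct? p = ¬? (proj₁ p Fin.≟ proj₂ p)

distinctPairs : (k : ℕ) → List (Fin k × Fin k)
distinctPairs k = filter distinct? (elements (pairs k))

module _ {k m : ℕ} {f : Vec (Fin m) k} where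

  separates-distinctPairs⇒injective : Separates (distinctPairs k) f → Injective _≡_ _≡_ (lookup f)
  separates-distinctPairs⇒injective sep {x} {y} fx≡fy with x Fin.≟ y
  ... | yes x≡y = x≡y
  ... | no x≢y = contradiction fx≡fy
    (All.lookup sep (∈-filter⁺ distinct? (complete (pairs k) (x , y)) x≢y))

  injective⇒separates-distinctPairs : Injective _≡_ _≡_ (lookup f) → Separates (distinctPairs k) f
  injective⇒separates-distinctPairs f-injective = All.tabulate λ p∈ fp≡fq →
    proj₂ (∈-filter⁻ distinct? {xs = elements (pairs k)} p∈) (f-injective fp≡fq)

InjectiveHom : ∀ {r} (G K : RGraph r) → Map G K → Set
InjectiveHom G K = SepHom G K (distinctPairs (n (graph G)))

edge? : (A : Graph) → Decidable (λ (p : Fin (n A) × Fin (n A)) → Edge A (proj₁ p) (proj₂ p))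
edge? A p = T? (adj A (proj₁ p) (proj₂ p))

edges : (A : Graph) → List (Fin (n A) × Fin (n A))
edges A = filter (edge? A) (elements (pairs (n A)))

module _ {A B : Graph} {F : Fin (n A) → Fin (n B)} (F-injective : Injective _≡_ _≡_ F)
         (F-hom : ∀ u v → Edge A u v → Edge B (F u) (F v)) where

  private
    F² : Fin (n A) × Fin (n A) → Fin (n B) × Fin (n B)
    F² = Product.map F F

    F²-injective : Injective _≡_ _≡_ F²
    F²-injective eq = cong₂ _,_ (F-injective (cong proj₁ eq)) (F-injective (cong proj₂ eq))

    F²-edges-unique : Unique (map F² (edges A))
    F²-edges-unique = Unique.map⁺ F²-injective (Unique.filter⁺ _ (unique (pairs (n A))))

    F²-edges⊆edges : map F² (edges A) ⊆ edges B
    F²-edges⊆edges e∈ with (u , v) , uv∈ , refl ← ∈-map⁻ F² e∈ =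
      ∈-filter⁺ _ (complete (pairs (n B)) (F u , F v))
        (F-hom u v (proj₂ (∈-filter⁻ (edge? A) {xs = elements (pairs (n A))} uv∈)))

  length-edges-≤ : length (edges A) ≤ length (edges B)
  length-edges-≤ = subst (_≤ length (edges B)) (length-map F² (edges A))
    (Unique-⊆⇒length≤ F²-edges-unique F²-edges⊆edges)

  reflects-edges : length (edges B) ≤ length (edges A) → ∀ u v → Edge B (F u) (F v) → Edge A u v
  reflects-edges |B|≤|A| u v e
    with (a , b) , ab∈ , eq ← ∈-map⁻ F²
           (Unique-⊆-length≥⇒⊇ (Product.≡-dec Fin._≟_ Fin._≟_) F²-edges-unique F²-edges⊆edges
           (subst (length (edges B) ≤_) (sym (length-map F² (edges A))) |B|≤|A|)
           (∈-filter⁺ _ (complete (pairs (n B)) (F u , F v)) e))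
    with refl ← F-injective (cong proj₁ eq) | refl ← F-injective (cong proj₂ eq) =
    proj₂ (∈-filter⁻ (edge? A) {xs = elements (pairs (n A))} ab∈)

  adj-preserved : length (edges B) ≤ length (edges A) → ∀ u v → adj B (F u) (F v) ≡ adj A u v
  adj-preserved |B|≤|A| u v = does-⇔ (mk⇔ (reflects-edges |B|≤|A| u v) (F-hom u v)) (T? _) (T? _)

  allFin⊆image : n B ≤ n A → allFin (n B) ⊆ map F (allFin (n A))
  allFin⊆image |B|≤|A| =
    Unique-⊆-length≥⇒⊇ Fin._≟_ (Unique.map⁺ F-injective (Unique.allFin⁺ (n A))) (λ _ → ∈-allFin _)
    (subst₂ _≤_ (sym (length-tabulate id)) (sym (trans (length-map F (allFin (n A))) (length-tabulate id))) |B|≤|A|)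

  surjective : n B ≤ n A → ∀ y → ∃ λ x → F x ≡ y
  surjective |B|≤|A| y with x , _ , y≡Fx ← ∈-map⁻ F (allFin⊆image |B|≤|A| (∈-allFin y)) = x , sym y≡Fx

injectiveHoms⇒≅ : ∀ {r} {G H : RGraph r} → ∃ (InjectiveHom G H) → ∃ (InjectiveHom H G) → G ≅ H
injectiveHoms⇒≅ {G = G} {H} (f , (f-hom , f-dist) , f-sep) (g , (g-hom , _) , g-sep) =
  lookup f , F⁻ , (λ u → f-injective (proj₂ (onto (lookup f u)))) , (λ v → proj₂ (onto v)) ,
  adj-preserved {graph G} {graph H} f-injective f-hom (length-edges-≤ {graph H} {graph G} g-injective g-hom) , f-dist
  where
  f-injective : Injective _≡_ _≡_ (lookup f)
  f-injective = separates-distinctPairs⇒injective {f = f} f-sep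
  g-injective : Injective _≡_ _≡_ (lookup g)
  g-injective = separates-distinctPairs⇒injective {f = g} g-sep
  onto : ∀ v → ∃ λ u → lookup f u ≡ v
  onto = surjective {graph G} {graph H} f-injective f-hom (Fin.injective⇒≤ g-injective)
  F⁻ : Fin (n (graph H)) → Fin (n (graph G))
  F⁻ v = proj₁ (onto v)

-- The fallback y is junk: invert is only used on surjective maps.
invert : ∀ {k} → (Fin k → Fin k) → Fin k → Fin k
invert F y with Fin.any? (λ x → F x Fin.≟ y)
... | yes (x , _) = x
... | no _        = y

invert-correct : ∀ {k} {F : Fin k → Fin k} → (∀ y → ∃ λ x → F x ≡ y) → ∀ y → F (invert F y) ≡ y
invert-correct {F = F} onto y with Fin.any? (λ x → F x Fin.≟ y)
... | yes (_ , Fx≡y) = Fx≡y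
... | no none        = contradiction (onto y) none

module Automorphisms {r : ℕ} (H : RGraph r) where

  IsAut : Map H H → Set
  IsAut = InjectiveHom H H

  isAut? : Decidable IsAut
  isAut? = sepHom? H H (distinctPairs (n (graph H)))

  identity : Map H H
  identity = tabulate id

  inverse : Map H H → Map H H
  inverse σ = tabulate (invert (lookup σ))

  module _ {σ : Map H H} (σ-aut : IsAut σ) where

    σ-injective : Injective _≡_ _≡_ (lookup σ)
    σ-injective = separates-distinctPairs⇒injective {f = σ} (proj₂ σ-aut)

    adj-σ : ∀ u v → adj (graph H) (lookup σ u) (lookup σ v) ≡ adj (graph H) u v
    adj-σ = adj-preserved {graph H} {graph H} σ-injective (proj₁ (proj₁ σ-aut)) ≤-refl

    σ∘inverse : ∀ y → lookup σ (lookup (inverse σ) y) ≡ y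
    σ∘inverse y = trans (cong (lookup σ) (lookup∘tabulate _ y))
      (invert-correct (surjective {graph H} {graph H} σ-injective (proj₁ (proj₁ σ-aut)) ≤-refl) y)

    inverse∘σ : ∀ x → lookup (inverse σ) (lookup σ x) ≡ x
    inverse∘σ x = σ-injective (σ∘inverse (lookup σ x))

    inverse-aut : IsAut (inverse σ)
    inverse-aut = (inverse-hom , dists) , injective⇒separates-distinctPairs {f = inverse σ} inverse-injective
      where
      inverse-hom : ∀ u v → Edge (graph H) u v → Edge (graph H) (lookup (inverse σ) u) (lookup (inverse σ) v)
      inverse-hom u v e = subst T (adj-σ _ _) (subst₂ (Edge (graph H)) (sym (σ∘inverse u)) (sym (σ∘inverse v)) e)
      dists : ∀ j → lookup (inverse σ) (dist H j) ≡ dist H j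
      dists j = trans (cong (lookup (inverse σ)) (sym (proj₂ (proj₁ σ-aut) j))) (inverse∘σ (dist H j))
      inverse-injective : Injective _≡_ _≡_ (lookup (inverse σ))
      inverse-injective {a} {b} eq = trans (sym (σ∘inverse a)) (trans (cong (lookup σ) eq) (σ∘inverse b))

    fixed⇒identity : InvolutionFree H → inverse σ ≡ σ → σ ≡ identity
    fixed⇒identity free fixed with Fin.all? (λ x → lookup σ x Fin.≟ x)
    ... | yes σ≗id = lookup-ext λ x → trans (σ≗id x) (sym (lookup∘tabulate id x))
    ... | no σ≢id = contradiction
      (lookup σ , lookup σ , σ² , σ² , adj-σ , proj₂ (proj₁ σ-aut) , σ² ,
       Fin.¬∀⟶∃¬ _ _ (λ x → lookup σ x Fin.≟ x) σ≢id) free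
      where
      σ² : ∀ x → lookup σ (lookup σ x) ≡ x
      σ² x = trans (cong (λ τ → lookup σ (lookup τ x)) (sym fixed)) (σ∘inverse x)

  inverse-involutive : ∀ {σ} → IsAut σ → inverse (inverse σ) ≡ σ
  inverse-involutive {σ} σ-aut = lookup-ext λ x →
    σ-injective {inverse σ} τ-aut (trans (σ∘inverse {inverse σ} τ-aut x) (sym (inverse∘σ {σ} σ-aut x)))
    where
    τ-aut : IsAut (inverse σ)
    τ-aut = inverse-aut {σ} σ-aut

  identity-aut : IsAut identity
  identity-aut = (identity-hom , λ j → lookup∘tabulate id (dist H j)) ,
    injective⇒separates-distinctPairs {f = identity} λ {a} {b} eq →
      trans (sym (lookup∘tabulate id a)) (trans eq (lookup∘tabulate id b))
    where
    identity-hom : ∀ u v → Edge (graph H) u v → Edge (graph H) (lookup identity u) (lookup identity v)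
    identity-hom u v = subst₂ (Edge (graph H)) (sym (lookup∘tabulate id u)) (sym (lookup∘tabulate id v))

  inverse-identity : inverse identity ≡ identity
  inverse-identity = lookup-ext λ y →
    trans (sym (lookup∘tabulate id _)) (trans (σ∘inverse {identity} identity-aut y) (sym (lookup∘tabulate id y)))

  autCount-odd : InvolutionFree H → count isAut? (elements (mapsBetween H H)) ≡₂ 1
  autCount-odd free =
    trans (count≡₂count-fixed lex-compare inverse isAut?
             (λ {σ} → inverse-aut {σ}) (λ {σ} → inverse-involutive {σ}) (mapsBetween H H))
          (cong (_% 2) fixedCount≡1)
    where
    fixedCount≡1 : count (isAut? ∩? fixed? lex-compare inverse) (elements (mapsBetween H H)) ≡ 1
    fixedCount≡1 = trans
      (count-≐ _ (λ σ → Vec.≡-dec Fin._≟_ σ identity)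
        ((λ (σ-aut , fixed) → fixed⇒identity σ-aut free fixed) , λ { refl → identity-aut , inverse-identity })
        (elements (mapsBetween H H)))
      (count-≡ (Vec.≡-dec Fin._≟_) identity (unique (mapsBetween H H)) (complete (mapsBetween H H) identity))

sameParity⇒injectiveHom : ∀ {r} {H H′ : RGraph r} → InvolutionFree H →
  (∀ G → homCount G H ≡₂ homCount G H′) → ∃ (InjectiveHom H H′)
sameParity⇒injectiveHom {H = H} {H′} free same =
  count≢0⇒∃ (sepHom? H H′ D) (elements (mapsBetween H H′)) λ count≡0 → 1≢0 (begin
    1 % 2                  ≡⟨ autCount-odd free ⟨
    sepHomCount H H D % 2  ≡⟨ sepHomCount-≡₂ {H = H} {H′} same H D ⟩
    sepHomCount H H′ D % 2 ≡⟨ cong (_% 2) count≡0 ⟩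
    0 % 2                  ∎)
  where
  open Automorphisms H
  open ≡-Reasoning
  D : VertexPairs H
  D = distinctPairs (n (graph H))
  1≢0 : 1 % 2 ≢ 0 % 2
  1≢0 ()

lemma3p6 : (r : ℕ) (H H' : RGraph r) → InvolutionFree H → InvolutionFree H'
    → ((H ≅ H') → ((G : RGraph r) → homCount G H % 2 ≡ homCount G H' % 2))
    × (((G : RGraph r) → homCount G H % 2 ≡ homCount G H' % 2) → (H ≅ H'))
lemma3p6 r H H′ free free′ =
  (λ iso G → cong (_% 2) (homCount-resp-≅ {G = H} {H′} iso G)) ,
  λ same → injectiveHoms⇒≅ {G = H} {H′} (sameParity⇒injectiveHom {H = H} {H′} free same)
                                        (sameParity⇒injectiveHom {H = H′} {H} free′ (sym ∘ same))
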